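{- Let $p$ be a prime greater than $3$ and let $u$ be a positive integer coprime to $p$. Let $a_1,a_2,a_3,\alpha_1,\alpha_2,\alpha_3$ be positive integers. Assume that the ternary diagonal $\mathbb{Z}$-lattice $\langle a_1,a_2,a_3\rangle$ is isometric over $\mathbb{Z}_p$ to $\langle 1,-\Delta_p\rangle\perp\langle p\epsilon_p\rangle$ for some $\epsilon_p\in\mathbb{Z}_p^\times$. Then there is an integer $v$ such that (i) $0<v<p^2$; (ii) $uv+a_1\alpha_1^2+a_2\alpha_2^2$ is not represented by $\langle a_1,a_2\rangle$ over $\mathbb{Z}_p$; (iii) $uv+a_1\alpha_1^2+a_2\alpha_2^2+a_3\alpha_3^2$ is represented by $\langle a_1,a_2,a_3\rangle$ over $\mathbb{Z}_p$; (iv) $\max\big(\mathrm{ord}_p(uv+a_1\alpha_1^2+a_2\alpha_2^2),\ \mathrm{ord}_p(uv+a_1\alpha_1^2+a_2\alpha_2^2+a_3\alpha_3^2)\big)\le 1$.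
   Context: $\Delta_p$ denotes a non-square unit in $\mathbb{Z}_p$. $\langle b_1,\dots,b_k\rangle$ denotes the lattice with diagonal Gram matrix with entries $b_1,\dots,b_k$; an integer $n$ is represented by $\langle b_1,\dots,b_k\rangle$ over $\mathbb{Z}_p$ if $b_1x_1^2+\cdots+b_kx_k^2=n$ has a solution in $\mathbb{Z}_p^k$. $\mathrm{ord}_p$ is the $p$-adic valuation. -}

module Defs where

open import Data.Nat as ℕ using (ℕ; zero; suc)
open import Data.Integer using (ℤ; +_; _+_; _*_; -_; _-_)
open import Data.Integer.Divisibility using (_∣_)
open import Data.Fin using (Fin) renaming (zero to fz; suc to fs)
open import Data.Product using (Σ; _×_)
open import Relation.Nullary using (¬_)

-- p-adic integers ℤ_p, realised as the inverse limit  lim ℤ/p^k ℤ :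
-- a p-adic integer is a coherent sequence (x_k)_k of integers, x_k being
-- a representative of the residue class mod p^k, with
-- x_{k+1} ≡ x_k (mod p^k).

_≡_[mod_] : ℤ → ℤ → ℤ → Set
a ≡ b [mod m ] = m ∣ (a - b)

pow : ℕ → ℕ → ℤ
pow p k = + (p ℕ.^ k)

Seq : Set
Seq = ℕ → ℤ

record ℤ[_] (p : ℕ) : Set where
  constructor padic
  field
    digit : Seq
    coh   : ∀ k → digit (suc k) ≡ digit k [mod pow p k ]
open ℤ[_] public

_⊕_ : Seq → Seq → Seq
(f ⊕ g) k = f k + g k
infixl 6 _⊕_

_⊗_ : Seq → Seq → Seq
(f ⊗ g) k = f k * g k
infixl 7 _⊗_

⊖_ : Seq → Seq
(⊖ f) k = - f k

cst : ℤ → Seq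
cst n k = n

_≈[_]_ : Seq → ℕ → Seq → Set
f ≈[ p ] g = ∀ k → f k ≡ g k [mod pow p k ]

∑ : ∀ {n} → (Fin n → Seq) → Seq
∑ {zero}  f = cst (+ 0)
∑ {suc n} f = f fz ⊕ ∑ (λ i → f (fs i))

IsUnit : (p : ℕ) → ℤ[ p ] → Set
IsUnit p x = Σ ℤ[ p ] λ y → (digit x ⊗ digit y) ≈[ p ] cst (+ 1)

IsSquare : (p : ℕ) → ℤ[ p ] → Set
IsSquare p x = Σ ℤ[ p ] λ y → (digit y ⊗ digit y) ≈[ p ] digit x

RepZp : (p : ℕ) {m : ℕ} → (Fin m → ℤ) → ℤ → Set
RepZp p {m} b n = Σ (Fin m → ℤ[ p ]) λ x →
  ∑ (λ i → cst (b i) ⊗ digit (x i) ⊗ digit (x i)) ≈[ p ] cst n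

Mat : ℕ → ℕ → Set
Mat p m = Fin m → Fin m → ℤ[ p ]

_·_[_] : ∀ {p m} → Mat p m → Mat p m → Fin m → Fin m → Seq
(S · T [ i ]) j = ∑ (λ k → digit (S i k) ⊗ digit (T k j))

δ : ∀ {m} → Fin m → Fin m → Seq
δ fz     fz     = cst (+ 1)
δ fz     (fs j) = cst (+ 0)
δ (fs i) fz     = cst (+ 0)
δ (fs i) (fs j) = δ i j

IsInvertible : (p : ℕ) {m : ℕ} → Mat p m → Set
IsInvertible p {m} T = Σ (Mat p m) λ S →
  (∀ i j → (S · T [ i ]) j ≈[ p ] δ i j) ×
  (∀ i j → (T · S [ i ]) j ≈[ p ] δ i j)

IsometricZp : (p : ℕ) {m : ℕ} → (Fin m → Fin m → Seq) → (Fin m → Fin m → Seq) → Set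
IsometricZp p {m} G H = Σ (Mat p m) λ T → IsInvertible p T ×
  (∀ i j → ∑ (λ k → ∑ (λ l → digit (T k i) ⊗ G k l ⊗ digit (T l j))) ≈[ p ] H i j)

diag : ∀ {m} → (Fin m → Seq) → Fin m → Fin m → Seq
diag d i j = d i ⊗ δ i j

vec2 : ℤ → ℤ → Fin 2 → ℤ
vec2 x y fz = x
vec2 x y (fs _) = y

vec3 : {A : Set} → A → A → A → Fin 3 → A
vec3 x y z fz = x
vec3 x y z (fs fz) = y
vec3 x y z (fs (fs _)) = z

open import Data.Nat.Divisibility as ℕD using ()

Ord : ℕ → ℕ → ℕ → Set
Ord p n k = (p ℕ.^ k) ℕD.∣ n × ¬ ((p ℕ.^ suc k) ℕD.∣ n)

-- Reducing TᵗGT = H modulo p² and taking determinants gives a₁a₂a₃(det T)² ≡ -pΔε, so p divides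
-- a₁a₂a₃ exactly once:
-- exactly one aᵢ is divisible by p. As u is invertible modulo p², v can be chosen to give
-- N = uv + a₁α₁² + a₂α₂² and M = N + a₃α₃² any prescribed residues modulo p².
-- If p divides a₁ (or a₂), then ⟨a₁,a₂⟩ ≡ ⟨b⟩ modulo p for the other coefficient b. Taking
-- N ≡ bΔσ², b times a non-square, N is not represented, while the unit M is a value of ⟨b,a₃⟩
-- modulo p (pigeonhole on squares) and lifts by Hensel's lemma.
-- If p ∥ a₃, the upper-left 2×2 block of the Gram matrix shows that -a₁a₂ is Δ times a square,
-- so ⟨a₁,a₂⟩ is anisotropic modulo p. Taking N ≡ a₃(τ² - α₃²) and M ≡ a₃τ² modulo p², both
-- have valuation 1; a value of ⟨a₁,a₂⟩ divisible by p is divisible by p², so N is not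
-- represented, and M = a₃y² by Hensel's lemma.

module Submission where

module Proof where

  open import Data.Empty using (⊥-elim)
  open import Data.Fin using (Fin; toℕ; fromℕ<; splitAt; join)
  open import Data.Fin.Patterns using (0F; 1F; 2F)
  import Data.Fin.Properties as Fin
  open import Data.Integer
    using (ℤ; +_; -[1+_]; _+_; _*_; -_; _-_; NonZero) renaming (∣_∣ to abs)
  open import Data.Integer.DivMod using (_%_; _/_; n%d<d; a≡a%n+[a/n]*n)
  open import Data.Integer.Divisibility.Signed
    using (_∣_; divides; ∣ᵤ⇒∣; ∣⇒∣ᵤ; _∣?_; ∣-refl; ∣-trans; ∣m∣n⇒∣m+n; ∣m∣n⇒∣m-n; ∣m⇒∣-m;
           ∣n⇒∣m*n; ∣m⇒∣m*n; *-cancelˡ-∣)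
  import Data.Integer.Properties as ℤ
  open import Data.Integer.Tactic.RingSolver using (solve-∀)
  open import Data.Nat as ℕ using (ℕ; zero; suc; _<_; _≤_; _⊔_; z≤n; s≤s)
  open import Data.Nat.Coprimality using (Coprime; coprime-Bézout; coprime-divisor)
  import Data.Nat.Divisibility as ℕ
  open import Data.Nat.GCD using (module Bézout)
  open import Data.Nat.Primality
    using (Prime; euclidsLemma; prime⇒irreducible; prime⇒nonZero; prime⇒nonTrivial)
  import Data.Nat.Properties as ℕ
  open import Data.Product using (Σ; _×_; _,_; proj₁; proj₂)
  open import Data.Sum as Sum using (_⊎_; inj₁; inj₂; [_,_]′)
  open import Data.Vec.Functional using (_∷_; tail)
  open import Function using (id; _∘_)
  open import Level using (0ℓ)
  open import Relation.Binary.Bundles using (Setoid)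
  open import Relation.Binary.Definitions using (tri<; tri≈; tri>)
  open import Relation.Binary.PropositionalEquality
    using (_≡_; _≢_; refl; sym; trans; cong; cong₂; subst; module ≡-Reasoning)
  open import Relation.Nullary using (¬_; yes; no)

  open import Defs

  -- Congruence as a record: Defs' _≡_[mod_] unfolds to divisibility of ∣ a - b ∣, from which
  -- Agda cannot recover a and b when solving implicit arguments.
  infix 4 _≋_[mod_]

  record _≋_[mod_] (a b m : ℤ) : Set where
    constructor congruent
    field
      ∣difference : m ∣ (a - b)
  open _≋_[mod_]

  module _ {m : ℤ} where

    ≋⇒≡-mod : ∀ {a b} → a ≋ b [mod m ] → a ≡ b [mod m ]
    ≋⇒≡-mod h = ∣⇒∣ᵤ (∣difference h)

    ≡-mod⇒≋ : ∀ {a b} → a ≡ b [mod m ] → a ≋ b [mod m ]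
    ≡-mod⇒≋ h = congruent (∣ᵤ⇒∣ h)

    ≡⇒≋ : ∀ {a b} → a ≡ b → a ≋ b [mod m ]
    ≡⇒≋ {a} refl = congruent (subst (m ∣_) (sym (ℤ.+-inverseʳ a)) (divides (+ 0) refl))

    ≋-refl : ∀ {a} → a ≋ a [mod m ]
    ≋-refl = ≡⇒≋ refl

    ≋-sym : ∀ {a b} → a ≋ b [mod m ] → b ≋ a [mod m ]
    ≋-sym {a} {b} (congruent h) = congruent (subst (m ∣_) (flip a b) (∣m⇒∣-m h))
      where
      flip : ∀ a b → - (a - b) ≡ b - a
      flip = solve-∀

    ≋-trans : ∀ {a b c} → a ≋ b [mod m ] → b ≋ c [mod m ] → a ≋ c [mod m ]
    ≋-trans {a} {b} {c} (congruent h) (congruent k) = congruent (subst (m ∣_) (chain a b c) (∣m∣n⇒∣m+n h k))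
      where
      chain : ∀ a b c → (a - b) + (b - c) ≡ a - c
      chain = solve-∀

    +-cong-≋ : ∀ {a b c d} → a ≋ b [mod m ] → c ≋ d [mod m ] → a + c ≋ b + d [mod m ]
    +-cong-≋ {a} {b} {c} {d} (congruent h) (congruent k) =
      congruent (subst (m ∣_) (regroup a b c d) (∣m∣n⇒∣m+n h k))
      where
      regroup : ∀ a b c d → (a - b) + (c - d) ≡ (a + c) - (b + d)
      regroup = solve-∀

    *-cong-≋ : ∀ {a b c d} → a ≋ b [mod m ] → c ≋ d [mod m ] → a * c ≋ b * d [mod m ]
    *-cong-≋ {a} {b} {c} {d} (congruent h) (congruent k) =
      congruent (subst (m ∣_) (regroup a b c d) (∣m∣n⇒∣m+n (∣m⇒∣m*n c h) (∣n⇒∣m*n b k)))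
      where
      regroup : ∀ a b c d → (a - b) * c + b * (c - d) ≡ a * c - b * d
      regroup = solve-∀

    *-congˡ-≋ : ∀ a {b c} → b ≋ c [mod m ] → a * b ≋ a * c [mod m ]
    *-congˡ-≋ a = *-cong-≋ (≋-refl {a})

    *-congʳ-≋ : ∀ a {b c} → b ≋ c [mod m ] → b * a ≋ c * a [mod m ]
    *-congʳ-≋ a b≋c = *-cong-≋ b≋c (≋-refl {a})

    +-congˡ-≋ : ∀ a {b c} → b ≋ c [mod m ] → a + b ≋ a + c [mod m ]
    +-congˡ-≋ a = +-cong-≋ (≋-refl {a})

    +-congʳ-≋ : ∀ a {b c} → b ≋ c [mod m ] → b + a ≋ c + a [mod m ]
    +-congʳ-≋ a b≋c = +-cong-≋ b≋c (≋-refl {a})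

    -‿cong-≋ : ∀ {a b} → a ≋ b [mod m ] → - a ≋ - b [mod m ]
    -‿cong-≋ {a} {b} (congruent h) = congruent (subst (m ∣_) (regroup a b) (∣m⇒∣-m h))
      where
      regroup : ∀ a b → - (a - b) ≡ - a - - b
      regroup = solve-∀

    −-cong-≋ : ∀ {a b c d} → a ≋ b [mod m ] → c ≋ d [mod m ] → a - c ≋ b - d [mod m ]
    −-cong-≋ a≋b c≋d = +-cong-≋ a≋b (-‿cong-≋ c≋d)

    ≋-setoid : Setoid 0ℓ 0ℓ
    ≋-setoid = record
      { Carrier = ℤ
      ; _≈_ = _≋_[mod m ]
      ; isEquivalence = record { refl = ≋-refl ; sym = ≋-sym ; trans = ≋-trans }
      }

    ∣⇒≋0 : ∀ {a} → m ∣ a → a ≋ + 0 [mod m ]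
    ∣⇒≋0 {a} h = congruent (subst (m ∣_) (sym (ℤ.+-identityʳ a)) h)

    ≋0⇒∣ : ∀ {a} → a ≋ + 0 [mod m ] → m ∣ a
    ≋0⇒∣ {a} (congruent h) = subst (m ∣_) (ℤ.+-identityʳ a) h

    ≋-∣ : ∀ {a b} → a ≋ b [mod m ] → m ∣ a → m ∣ b
    ≋-∣ h k = ≋0⇒∣ (≋-trans (≋-sym h) (∣⇒≋0 k))

    +-∣-≋ : ∀ a {e} → m ∣ e → a + e ≋ a [mod m ]
    +-∣-≋ a {e} m∣e = congruent (subst (m ∣_) (regroup a e) m∣e)
      where
      regroup : ∀ a e → e ≡ a + e - a
      regroup = solve-∀

    ≋-subʳ : ∀ a b {c} → a + b ≋ c [mod m ] → a ≋ c - b [mod m ]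
    ≋-subʳ a b {c} (congruent h) = congruent (subst (m ∣_) (regroup a b c) h)
      where
      regroup : ∀ a b c → a + b - c ≡ a - (c - b)
      regroup = solve-∀

    ≋-subˡ : ∀ a b {c} → a + b ≋ c [mod m ] → b ≋ c - a [mod m ]
    ≋-subˡ a b {c} (congruent h) = congruent (subst (m ∣_) (regroup a b c) h)
      where
      regroup : ∀ a b c → a + b - c ≡ b - (c - a)
      regroup = solve-∀

    ≋-weaken : ∀ {n a b} → n ∣ m → a ≋ b [mod m ] → a ≋ b [mod n ]
    ≋-weaken n∣m (congruent h) = congruent (∣-trans n∣m h)

  module ≋-Reasoning (m : ℤ) where
    open import Relation.Binary.Reasoning.Setoid (≋-setoid {m}) public

  ∣-m⇒∣m : ∀ {i m} → i ∣ - m → i ∣ m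
  ∣-m⇒∣m {i} {m} i∣-m = subst (i ∣_) (ℤ.neg-involutive m) (∣m⇒∣-m i∣-m)

  ∣-*-∣ : ∀ {a b x y} → a ∣ x → b ∣ y → a * b ∣ x * y
  ∣-*-∣ {a} {b} (divides q refl) (divides r refl) = divides (q * r) (regroup q a r b)
    where
    regroup : ∀ q a r b → q * a * (r * b) ≡ q * r * (a * b)
    regroup = solve-∀

  %-≋ : ∀ a d .{{_ : NonZero d}} → + (a % d) ≋ a [mod d ]
  %-≋ a d = congruent (divides (- (a / d)) (begin
    + (a % d) - a                         ≡⟨ cong (λ t → + (a % d) - t) (a≡a%n+[a/n]*n a d) ⟩
    + (a % d) - (+ (a % d) + (a / d) * d) ≡⟨ cancel (+ (a % d)) (a / d) d ⟩
    - (a / d) * d                         ∎))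
    where
    open ≡-Reasoning
    cancel : ∀ r q d → r - (r + q * d) ≡ - q * d
    cancel = solve-∀

  -- p-adic integers and Hensel's lemma

  pow-suc : ∀ p k → pow p (suc k) ≡ + p * pow p k
  pow-suc p k = ℤ.pos-* p (p ℕ.^ k)

  pow-1 : ∀ p → pow p 1 ≡ + p
  pow-1 p = cong +_ (ℕ.*-identityʳ p)

  pow-2 : ∀ p → pow p 2 ≡ + p * + p
  pow-2 p = trans (pow-suc p 1) (cong (+ p *_) (pow-1 p))

  pow-∣-pow-suc : ∀ p k → pow p k ∣ pow p (suc k)
  pow-∣-pow-suc p k = divides (+ p) (pow-suc p k)

  p∣pow-suc : ∀ p k → + p ∣ pow p (suc k)
  p∣pow-suc p k = divides (pow p k) (trans (pow-suc p k) (ℤ.*-comm (+ p) (pow p k)))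

  ∣-*-pow : ∀ {p} k {a b} → + p ∣ a → pow p k ∣ b → pow p (suc k) ∣ a * b
  ∣-*-pow {p} k {a} {b} p∣a pᵏ∣b = subst (λ q → q ∣ a * b) (sym (pow-suc p k)) (∣-*-∣ p∣a pᵏ∣b)

  fromℤ : ∀ {p} → ℤ → ℤ[ p ]
  fromℤ {p} x = padic (cst x) (λ k → ≋⇒≡-mod (≋-refl {pow p k} {x}))

  coh-≋ : ∀ {p} (x : ℤ[ p ]) k → digit x (suc k) ≋ digit x k [mod pow p k ]
  coh-≋ x k = ≡-mod⇒≋ (coh x k)

  digit-≋ : ∀ {p} (x : ℤ[ p ]) k → digit x (suc k) ≋ digit x 1 [mod + p ]
  digit-≋ x zero = ≋-refl
  digit-≋ {p} x (suc k) = ≋-trans (≋-weaken (p∣pow-suc p k) (coh-≋ x (suc k))) (digit-≋ x k)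

  -- Newton's iteration for c x² = m, with the derivative 2cx inverted once and for all:
  -- w ≡ (2cs)⁻¹ (mod p).
  module Newton {p : ℕ} (c : ℤ) (m : ℤ[ p ]) (s w : ℤ)
    (s-root : c * s * s ≋ digit m 1 [mod + p ]) (w-inverse : + 2 * c * s * w ≋ + 1 [mod + p ]) where

    x : ℕ → ℤ
    x zero    = s
    x (suc k) = x k - (c * x k * x k - digit m (suc (suc k))) * w

    invariant : ∀ k → x k ≋ s [mod + p ] × c * x k * x k ≋ digit m (suc k) [mod pow p (suc k) ]

    residual-small : ∀ k → pow p (suc k) ∣ c * x k * x k - digit m (suc (suc k))
    residual-small k = ∣difference (≋-trans (proj₂ (invariant k)) (≋-sym (coh-≋ m (suc k))))

    invariant zero = ≋-refl , subst (λ q → c * s * s ≋ digit m 1 [mod q ]) (sym (pow-1 p)) s-root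
    invariant (suc k) = x′≋s , congruent (subst (pow p (suc (suc k)) ∣_) (sym (newton-step c (x k) w m₂))
      (∣m∣n⇒∣m+n (∣-*-pow (suc k) slope (residual-small k))
                 (∣n⇒∣m*n (c * w * w) (∣-trans p²-step (∣-*-∣ (residual-small k) (residual-small k))))))
      where
      m₂ = digit m (suc (suc k))
      x′≋s : x (suc k) ≋ s [mod + p ]
      x′≋s = ≋-trans (+-∣-≋ (x k) (∣m⇒∣-m (∣m⇒∣m*n w (∣-trans (p∣pow-suc p k) (residual-small k)))))
                     (proj₁ (invariant k))
      slope : + p ∣ + 1 - + 2 * c * x k * w
      slope = ∣difference (≋-trans (≋-sym w-inverse)
        (*-congʳ-≋ w (*-congˡ-≋ (+ 2 * c) (≋-sym (proj₁ (invariant k))))))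
      p²-step : pow p (suc (suc k)) ∣ pow p (suc k) * pow p (suc k)
      p²-step = ∣-*-pow (suc k) (p∣pow-suc p k) ∣-refl
      -- The new residual is (1 - 2cxw)e + cw²e² for the old residual e, where p ∣ 1 - 2cxw and p^(k+1) ∣ e.
      newton-step : ∀ c x w n → c * (x - (c * x * x - n) * w) * (x - (c * x * x - n) * w) - n
        ≡ (+ 1 - + 2 * c * x * w) * (c * x * x - n) + c * w * w * ((c * x * x - n) * (c * x * x - n))
      newton-step = solve-∀

    x-coh : ∀ k → x (suc k) ≋ x k [mod pow p k ]
    x-coh k = +-∣-≋ (x k) (∣m⇒∣-m (∣m⇒∣m*n w (∣-trans (pow-∣-pow-suc p k) (residual-small k))))

    x-root : ∀ k → c * x k * x k ≋ digit m k [mod pow p k ]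
    x-root k = ≋-trans (≋-weaken (pow-∣-pow-suc p k) (proj₂ (invariant k))) (coh-≋ m k)

  UnaryRep : (p : ℕ) → ℤ → Seq → Set
  UnaryRep p c m = Σ ℤ[ p ] λ y → (cst c ⊗ digit y ⊗ digit y) ≈[ p ] m

  hensel-lift : ∀ {p} c (m : ℤ[ p ]) s w →
    c * s * s ≋ digit m 1 [mod + p ] → + 2 * c * s * w ≋ + 1 [mod + p ] → UnaryRep p c (digit m)
  hensel-lift c m s w s-root w-inverse = padic x (λ k → ≋⇒≡-mod (x-coh k)) , λ k → ≋⇒≡-mod (x-root k)
    where open Newton c m s w s-root w-inverse

  -- Values of diagonal forms

  form : ∀ {n} → (Fin n → ℤ) → (Fin n → ℤ) → ℤ
  form {zero}  b x = + 0
  form {suc n} b x = b 0F * x 0F * x 0F + form (tail b) (tail x)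

  module _ {p : ℕ} where

    ∑-form : ∀ {n} (b : Fin n → ℤ) (X : Fin n → ℤ[ p ]) k →
      ∑ (λ i → cst (b i) ⊗ digit (X i) ⊗ digit (X i)) k ≡ form b (λ i → digit (X i) k)
    ∑-form {zero}  b X k = refl
    ∑-form {suc n} b X k =
      cong (λ t → b 0F * digit (X 0F) k * digit (X 0F) k + t) (∑-form (tail b) (tail X) k)

    RepZp⇒residue : ∀ {n} (b : Fin n → ℤ) c → RepZp p b c →
      ∀ k → Σ (Fin n → ℤ) λ x → form b x ≋ c [mod pow p k ]
    RepZp⇒residue b c (X , X-rep) k =
      (λ i → digit (X i) k) , ≋-trans (≡⇒≋ (sym (∑-form b X k))) (≡-mod⇒≋ (X-rep k))

    form-represented : ∀ {n} (b x : Fin n → ℤ) → RepZp p b (form b x)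
    form-represented b x =
      (λ i → fromℤ (x i)) , λ k → ≋⇒≡-mod (≡⇒≋ {pow p k} (∑-form b (λ i → fromℤ (x i)) k))

    RepZp-∷ : ∀ {n} {b : Fin (suc n) → ℤ} {s r} →
      UnaryRep p (b 0F) (cst s) → RepZp p (tail b) r → RepZp p b (s + r)
    RepZp-∷ {b = b} {s} {r} (y , y-root) (X , X-rep) = (y ∷ X) , λ k → ≋⇒≡-mod (+-cong-≋ (y≋ k) (X≋ k))
      where
      y≋ : ∀ k → b 0F * digit y k * digit y k ≋ s [mod pow p k ]
      y≋ k = ≡-mod⇒≋ (y-root k)
      X≋ : ∀ k → ∑ (λ i → cst (tail b i) ⊗ digit (X i) ⊗ digit (X i)) k ≋ r [mod pow p k ]
      X≋ k = ≡-mod⇒≋ (X-rep k)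

    RepZp-third : ∀ a b c n → UnaryRep p c (cst n) → RepZp p (vec3 a b c) n
    RepZp-third a b c n (y , y-root) = vec3 (fromℤ (+ 0)) (fromℤ (+ 0)) y , λ k → ≋⇒≡-mod (sum k)
      where
      zeros : ∀ a b t → a * + 0 * + 0 + (b * + 0 * + 0 + (t + + 0)) ≡ t
      zeros = solve-∀
      sum : ∀ k → a * + 0 * + 0 + (b * + 0 * + 0 + (c * digit y k * digit y k + + 0)) ≋ n [mod pow p k ]
      sum k = ≋-trans (≡⇒≋ (zeros a b (c * digit y k * digit y k))) (≡-mod⇒≋ (y-root k))

  -- Modular inverses

  pos-Bézout : ∀ a b c d → 1 ℕ.+ a ℕ.* b ≡ c ℕ.* d → + 1 + + a * + b ≡ + c * + d
  pos-Bézout a b c d eq = begin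
    + 1 + + a * + b   ≡⟨ cong (λ t → + 1 + t) (ℤ.pos-* a b) ⟨
    + 1 + + (a ℕ.* b) ≡⟨ ℤ.pos-+ 1 (a ℕ.* b) ⟨
    + (1 ℕ.+ a ℕ.* b) ≡⟨ cong +_ eq ⟩
    + (c ℕ.* d)       ≡⟨ ℤ.pos-* c d ⟩
    + c * + d         ∎
    where open ≡-Reasoning

  coprime⇒inverse : ∀ {n m} → Coprime n m → Σ ℤ λ w → + n * w ≋ + 1 [mod + m ]
  coprime⇒inverse {n} {m} coprime with coprime-Bézout coprime
  ... | Bézout.+- x y eq = + x , congruent (divides (+ y) (begin
    + n * + x - + 1       ≡⟨ cong (_- + 1) (ℤ.*-comm (+ n) (+ x)) ⟩
    + x * + n - + 1       ≡⟨ cong (_- + 1) (pos-Bézout y m x n eq) ⟨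
    + 1 + + y * + m - + 1 ≡⟨ cancel (+ y * + m) ⟩
    + y * + m             ∎))
    where
    open ≡-Reasoning
    cancel : ∀ t → + 1 + t - + 1 ≡ t
    cancel = solve-∀
  ... | Bézout.-+ x y eq = - + x , congruent (divides (- + y) (begin
    + n * - + x - + 1     ≡⟨ regroup (+ n) (+ x) ⟩
    - (+ 1 + + x * + n)   ≡⟨ cong -_ (pos-Bézout x n y m eq) ⟩
    - (+ y * + m)         ≡⟨ ℤ.neg-distribˡ-* (+ y) (+ m) ⟩
    - + y * + m           ∎))
    where
    open ≡-Reasoning
    regroup : ∀ n x → n * - x - + 1 ≡ - (+ 1 + x * n)
    regroup = solve-∀

  coprime-* : ∀ {m n o} → Coprime m n → Coprime m o → Coprime m (n ℕ.* o)
  coprime-* m⊥n m⊥o (d∣m , d∣no) =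
    m⊥o (d∣m , coprime-divisor (λ (e∣d , e∣n) → m⊥n (ℕ.∣-trans e∣d d∣m , e∣n)) d∣no)

  coprime-^ : ∀ {m n} → Coprime m n → ∀ k → Coprime m (n ℕ.^ k)
  coprime-^ m⊥n zero    (d∣m , d∣1) = ℕ.∣1⇒≡1 d∣1
  coprime-^ m⊥n (suc k) = coprime-* m⊥n (coprime-^ m⊥n k)

  solve-linear : ∀ {u m} .{{_ : ℕ.NonZero m}} → Coprime u m →
    ∀ r → Σ ℕ λ v → v < m × + u * + v ≋ r [mod + m ]
  solve-linear {u} {m} u⊥m r = (w * r) % + m , n%d<d (w * r) (+ m) , (begin
    + u * + ((w * r) % + m) ≈⟨ *-congˡ-≋ (+ u) (%-≋ (w * r) (+ m)) ⟩
    + u * (w * r)           ≡⟨ ℤ.*-assoc (+ u) w r ⟨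
    + u * w * r             ≈⟨ *-congʳ-≋ r uw≋1 ⟩
    + 1 * r                 ≡⟨ ℤ.*-identityˡ r ⟩
    r                       ∎)
    where
    open ≋-Reasoning (+ m)
    w = proj₁ (coprime⇒inverse u⊥m)
    uw≋1 = proj₂ (coprime⇒inverse u⊥m)

  -- Arithmetic modulo a prime

  module PrimeModulus {p : ℕ} (p-prime : Prime p) where

    private instance
      p≢0 : ℕ.NonZero p
      p≢0 = prime⇒nonZero p-prime

    euclid : ∀ {a b} → + p ∣ a * b → + p ∣ a ⊎ + p ∣ b
    euclid {a} {b} p∣ab =
      Sum.map ∣ᵤ⇒∣ ∣ᵤ⇒∣
        (euclidsLemma (abs a) (abs b) p-prime (subst (p ℕ.∣_) (ℤ.abs-* a b) (∣⇒∣ᵤ p∣ab)))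

    ∤-* : ∀ {a b} → ¬ + p ∣ a → ¬ + p ∣ b → ¬ + p ∣ a * b
    ∤-* p∤a p∤b p∣ab = [ p∤a , p∤b ]′ (euclid p∣ab)

    ∣-square : ∀ {a} → + p ∣ a * a → + p ∣ a
    ∣-square p∣aa = [ id , id ]′ (euclid p∣aa)

    ∤-small : ∀ {k} → 0 < k → k < p → ¬ + p ∣ + k
    ∤-small {suc k} _ k<p p∣k = ℕ.>⇒∤ k<p (∣⇒∣ᵤ p∣k)

    ∤-1 : ¬ + p ∣ + 1
    ∤-1 = ∤-small (s≤s z≤n) (ℕ.nonTrivial⇒n>1 p {{prime⇒nonTrivial p-prime}})

    ∤⇒coprime : ∀ {n} → ¬ p ℕ.∣ n → Coprime n p
    ∤⇒coprime p∤n (d∣n , d∣p) with prime⇒irreducible p-prime d∣p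
    ... | inj₁ d≡1 = d≡1
    ... | inj₂ refl = ⊥-elim (p∤n d∣n)

    inverse : ∀ {a} → ¬ + p ∣ a → Σ ℤ λ w → a * w ≋ + 1 [mod + p ]
    inverse {+ n} p∤a = coprime⇒inverse (∤⇒coprime (p∤a ∘ ∣ᵤ⇒∣))
    inverse { -[1+ n ]} p∤a with coprime⇒inverse (∤⇒coprime {suc n} (p∤a ∘ ∣ᵤ⇒∣))
    ... | w , nw≋1 = - w , ≋-trans (≡⇒≋ (negate (+ suc n) w)) nw≋1
      where
      negate : ∀ a w → - a * - w ≡ a * w
      negate = solve-∀

    inverse⇒∤ : ∀ {a w} → a * w ≋ + 1 [mod + p ] → ¬ + p ∣ a
    inverse⇒∤ {a} {w} aw≋1 p∣a = ∤-1 (≋-∣ aw≋1 (∣m⇒∣m*n w p∣a))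

    cancel-≋ : ∀ {c a b} → ¬ + p ∣ c → c * a ≋ c * b [mod + p ] → a ≋ b [mod + p ]
    cancel-≋ {c} {a} {b} p∤c (congruent p∣ca-cb) =
      congruent ([ (λ p∣c → ⊥-elim (p∤c p∣c)) , id ]′ (euclid (subst (+ p ∣_) (factor c a b) p∣ca-cb)))
      where
      factor : ∀ c a b → c * a - c * b ≡ c * (a - b)
      factor = solve-∀

    unit-digit : ∀ {x : ℤ[ p ]} → IsUnit p x → ∀ k → ¬ + p ∣ digit x (suc k)
    unit-digit {x} (y , xy≈1) k = inverse⇒∤ (≋-weaken (p∣pow-suc p k) xy≋1)
      where
      xy≋1 : digit x (suc k) * digit y (suc k) ≋ + 1 [mod pow p (suc k) ]
      xy≋1 = ≡-mod⇒≋ (xy≈1 (suc k))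

    p∣p² : + p ∣ pow p 2
    p∣p² = p∣pow-suc p 1

    p∣⇒p²∣square : ∀ {x} → + p ∣ x → pow p 2 ∣ x * x
    p∣⇒p²∣square {x} p∣x = ∣-*-pow 1 p∣x (subst (_∣ x) (sym (pow-1 p)) p∣x)

    p²∣⇒p∣ : ∀ {e} → pow p 2 ∣ + p * e → + p ∣ e
    p²∣⇒p∣ {e} p²∣pe = *-cancelˡ-∣ (+ p) (subst (_∣ + p * e) (pow-2 p) p²∣pe)

    ord-zero : ∀ {n} → ¬ + p ∣ + n → Ord p n 0
    ord-zero {n} p∤n = ℕ.1∣ n , λ p¹∣n → p∤n (∣ᵤ⇒∣ (subst (ℕ._∣ n) (ℕ.*-identityʳ p) p¹∣n))

    ord-one : ∀ {n} → + p ∣ + n → ¬ pow p 2 ∣ + n → Ord p n 1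
    ord-one {n} p∣n p²∤n =
      subst (ℕ._∣ n) (sym (ℕ.*-identityʳ p)) (∣⇒∣ᵤ p∣n) , λ p²∣n → p²∤n (∣ᵤ⇒∣ p²∣n)

    exactly-p : ∀ {a e} → a ≋ + p * e [mod pow p 2 ] → ¬ + p ∣ e → + p ∣ a × ¬ pow p 2 ∣ a
    exactly-p a≋pe p∤e =
      ≋-∣ (≋-sym (≋-weaken p∣p² a≋pe)) (∣m⇒∣m*n _ ∣-refl) ,
      λ p²∣a → p∤e (p²∣⇒p∣ (≋-∣ a≋pe p²∣a))

    exactly-p-of-scaled : ∀ {a d e} → a * (d * d) ≋ + p * e [mod pow p 2 ] → ¬ + p ∣ e → + p ∣ a × ¬ pow p 2 ∣ a
    exactly-p-of-scaled {a} {d} {e} add≋pe p∤e = p∣a , p²∤a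
      where
      p∣add : + p ∣ a * (d * d)
      p∣add = proj₁ (exactly-p add≋pe p∤e)
      p²∤add : ¬ pow p 2 ∣ a * (d * d)
      p²∤add = proj₂ (exactly-p add≋pe p∤e)
      p∤d : ¬ + p ∣ d
      p∤d p∣d = p²∤add (∣n⇒∣m*n a (p∣⇒p²∣square p∣d))
      p∣a : + p ∣ a
      p∣a = [ id , (λ p∣dd → ⊥-elim (p∤d (∣-square p∣dd))) ]′ (euclid {a} {d * d} p∣add)
      p²∤a : ¬ pow p 2 ∣ a
      p²∤a p²∣a = p²∤add (∣m⇒∣m*n (d * d) p²∣a)

    ∤-difference : ∀ {x y} → x < y → y < p → ¬ + p ∣ + y - + x
    ∤-difference {x} {y} x<y y<p p∣y-x = ∤-small (ℕ.m<n⇒0<n∸m x<y) (ℕ.≤-<-trans (ℕ.m∸n≤m y x) y<p)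
      (subst (+ p ∣_) (trans (ℤ.m-n≡m⊖n y x) (ℤ.⊖-≥ (ℕ.<⇒≤ x<y))) p∣y-x)

    ∣-difference⇒≡ : ∀ {x y} → x < p → y < p → + p ∣ + x - + y → x ≡ y
    ∣-difference⇒≡ {x} {y} x<p y<p p∣x-y with ℕ.<-cmp x y
    ... | tri< x<y _ _ = ⊥-elim (∤-difference x<y y<p (subst (+ p ∣_) (flip (+ x) (+ y)) (∣m⇒∣-m p∣x-y)))
      where
      flip : ∀ a b → - (a - b) ≡ b - a
      flip = solve-∀
    ... | tri≈ _ x≡y _ = x≡y
    ... | tri> _ _ y<x = ⊥-elim (∤-difference y<x x<p p∣x-y)

    private
      h : ℕ
      h = ℕ.⌊ p /2⌋

      h+h≤p : h ℕ.+ h ≤ p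
      h+h≤p = subst (h ℕ.+ h ≤_) (ℕ.⌊n/2⌋+⌈n/2⌉≡n p) (ℕ.+-monoʳ-≤ h (ℕ.⌊n/2⌋≤⌈n/2⌉ p))

      p<S+S : p < suc h ℕ.+ suc h
      p<S+S = subst (_< suc h ℕ.+ suc h) (ℕ.⌊n/2⌋+⌈n/2⌉≡n p)
        (ℕ.+-mono-<-≤ (ℕ.n<1+n h) (ℕ.⌊n/2⌋-mono (ℕ.n≤1+n (suc p))))

      distinct-halves : ∀ {x y} → x ≤ h → y ≤ h → x ≢ y → x ℕ.+ y < p
      distinct-halves {x} {y} x≤h y≤h x≢y with ℕ.<-cmp x y
      ... | tri< x<y _ _ = ℕ.<-≤-trans (ℕ.+-monoˡ-< y x<y) (ℕ.≤-trans (ℕ.+-mono-≤ y≤h y≤h) h+h≤p)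
      ... | tri≈ _ x≡y _ = ⊥-elim (x≢y x≡y)
      ... | tri> _ _ y<x = ℕ.<-≤-trans (ℕ.+-monoʳ-< x y<x) (ℕ.≤-trans (ℕ.+-mono-≤ x≤h x≤h) h+h≤p)

      squares-injective : ∀ {a x y} → ¬ + p ∣ a → x ≤ h → y ≤ h →
        + p ∣ a * + x * + x - a * + y * + y → x ≡ y
      squares-injective {a} {x} {y} p∤a x≤h y≤h p∣difference with x ℕ.≟ y
      ... | yes x≡y = x≡y
      ... | no x≢y = [ ∣-difference⇒≡ x<p y<p , ⊥-elim ∘ p∤x+y ]′
            (euclid ([ ⊥-elim ∘ p∤a , id ]′ (euclid (subst (+ p ∣_) (factor a (+ x) (+ y)) p∣difference))))
        where
        factor : ∀ a x y → a * x * x - a * y * y ≡ a * ((x - y) * (x + y))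
        factor = solve-∀
        x+y<p = distinct-halves x≤h y≤h x≢y
        x<p = ℕ.≤-<-trans (ℕ.m≤m+n x y) x+y<p
        y<p = ℕ.≤-<-trans (ℕ.m≤n+m y x) x+y<p
        0<x+y : 0 < x ℕ.+ y
        0<x+y = ℕ.≤∧≢⇒< z≤n λ 0≡x+y → x≢y (trans (ℕ.m+n≡0⇒m≡0 x (sym 0≡x+y)) (sym (ℕ.m+n≡0⇒n≡0 x (sym 0≡x+y))))
        p∤x+y : ¬ + p ∣ + x + + y
        p∤x+y p∣x+y = ∤-small 0<x+y x+y<p (subst (+ p ∣_) (sym (ℤ.pos-+ x y)) p∣x+y)

      residue : ℤ → Fin p
      residue a = fromℕ< (n%d<d a (+ p))

      residue-≋ : ∀ a b → residue a ≡ residue b → a ≋ b [mod + p ]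
      residue-≋ a b eq = ≋-trans (≋-sym (%-≋ a (+ p))) (≋-trans (≡⇒≋ (cong +_ same)) (%-≋ b (+ p)))
        where
        same : a % + p ≡ b % + p
        same = trans (sym (Fin.toℕ-fromℕ< _)) (trans (cong toℕ eq) (Fin.toℕ-fromℕ< _))

    -- The values a x² and c - b y² for 0 ≤ x, y ≤ ⌊p/2⌋ are p + 1 or more residues, distinct within
    -- each family, so some a x² meets some c - b y².
    sum-of-squares : ∀ {a b} c → ¬ + p ∣ a → ¬ + p ∣ b →
      Σ ℤ λ x → Σ ℤ λ y → a * x * x + b * y * y ≋ c [mod + p ]
    sum-of-squares {a} {b} c p∤a p∤b = from-collision (Fin.pigeonhole p<S+S f)
      where
      value : Fin (suc h) ⊎ Fin (suc h) → ℤ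
      value (inj₁ x) = a * + toℕ x * + toℕ x
      value (inj₂ y) = c - b * + toℕ y * + toℕ y

      f : Fin (suc h ℕ.+ suc h) → Fin p
      f = residue ∘ value ∘ splitAt (suc h)

      ≤h : ∀ (x : Fin (suc h)) → toℕ x ≤ h
      ≤h x = ℕ.s≤s⁻¹ (Fin.toℕ<n x)

      Solution = Σ ℤ λ x → Σ ℤ λ y → a * x * x + b * y * y ≋ c [mod + p ]

      cancel : ∀ c u → c - u + u ≡ c
      cancel = solve-∀

      swap : ∀ c u v → (c - u) - (c - v) ≡ v - u
      swap = solve-∀

      mixed : ∀ {x y} → a * x * x ≋ c - b * y * y [mod + p ] → Solution
      mixed {x} {y} h = x , y , ≋-trans (+-congʳ-≋ (b * y * y) h) (≡⇒≋ (cancel c (b * y * y)))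

      collide : ∀ s t → s ≢ t → value s ≋ value t [mod + p ] → Solution
      collide (inj₁ x) (inj₁ x′) s≢t h = ⊥-elim (s≢t (cong inj₁ (Fin.toℕ-injective
        (squares-injective p∤a (≤h x) (≤h x′) (∣difference h)))))
      collide (inj₂ y) (inj₂ y′) s≢t h = ⊥-elim (s≢t (cong inj₂ (Fin.toℕ-injective (sym
        (squares-injective p∤b (≤h y′) (≤h y)
          (subst (+ p ∣_) (swap c (b * + toℕ y * + toℕ y) (b * + toℕ y′ * + toℕ y′)) (∣difference h)))))))
      collide (inj₁ x) (inj₂ y) _ h = mixed h
      collide (inj₂ y) (inj₁ x) _ h = mixed (≋-sym h)

      from-collision : (Σ _ λ i → Σ _ λ j → toℕ i < toℕ j × f i ≡ f j) → Solution
      from-collision (i , j , i<j , fi≡fj) =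
        collide (splitAt (suc h) i) (splitAt (suc h) j) split≢ (residue-≋ (value (splitAt (suc h) i)) _ fi≡fj)
        where
        split≢ : splitAt (suc h) i ≢ splitAt (suc h) j
        split≢ split≡ = Fin.<⇒≢ i<j (trans (sym (Fin.join-splitAt (suc h) (suc h) i))
                                     (trans (cong (join (suc h) (suc h)) split≡) (Fin.join-splitAt (suc h) (suc h) j)))

    exactly-one-divisible : ∀ {a b c} → + p ∣ a * b * c × ¬ pow p 2 ∣ a * b * c →
      (+ p ∣ a × ¬ + p ∣ b × ¬ + p ∣ c) ⊎ (¬ + p ∣ a × + p ∣ b × ¬ + p ∣ c) ⊎ (+ p ∣ c × ¬ pow p 2 ∣ c)
    exactly-one-divisible {a} {b} {c} (p∣abc , p²∤abc) with + p ∣? c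
    ... | yes p∣c = inj₂ (inj₂ (p∣c , λ p²∣c → p²∤abc (∣n⇒∣m*n (a * b) p²∣c)))
    ... | no p∤c = [ [ (λ p∣a → inj₁ (p∣a , p∤other p∣a , p∤c)) ,
                       (λ p∣b → inj₂ (inj₁ ((λ p∣a → p∤other p∣a p∣b) , p∣b , p∤c))) ]′ ∘ euclid {a} {b} ,
                     ⊥-elim ∘ p∤c ]′ (euclid {a * b} {c} p∣abc)
      where
      p∤other : + p ∣ a → ¬ + p ∣ b
      p∤other p∣a p∣b = p²∤abc (∣m⇒∣m*n c (subst (_∣ a * b) (sym (pow-2 p)) (∣-*-∣ p∣a p∣b)))

    module OddPrime (p∤2 : ¬ + p ∣ + 2) where

      hensel : ∀ c (m : ℤ[ p ]) s → ¬ + p ∣ c * s → c * s * s ≋ digit m 1 [mod + p ] → UnaryRep p c (digit m)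
      hensel c m s p∤cs s-root = hensel-lift c m s (proj₁ w) s-root (proj₂ w)
        where
        w = inverse (subst (λ t → ¬ + p ∣ t) (sym (ℤ.*-assoc (+ 2) c s)) (∤-* p∤2 p∤cs))

      -- Hensel-lift the first coordinate whose term bᵢxᵢ is a unit; one exists because p ∤ c.
      lift-unit-residue : ∀ {n} (b x : Fin n → ℤ) {c} → form b x ≋ c [mod + p ] → ¬ + p ∣ c → RepZp p b c
      lift-unit-residue {zero} b x h p∤c = ⊥-elim (p∤c (≋-∣ h (divides (+ 0) refl)))
      lift-unit-residue {suc n} b x {c} h p∤c with + p ∣? (b 0F * x 0F)
      ... | no p∤b₀x₀ = subst (RepZp p b) (regroup c F)
            (RepZp-∷ {b = b} {c - F} {F} (hensel (b 0F) (fromℤ (c - F)) (x 0F) p∤b₀x₀ (≋-subʳ t F h))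
                                         (form-represented (tail b) (tail x)))
        where
        t = b 0F * x 0F * x 0F
        F = form (tail b) (tail x)
        regroup : ∀ c F → c - F + F ≡ c
        regroup = solve-∀
      ... | yes p∣b₀x₀ = subst (RepZp p b) (regroup c t)
            (RepZp-∷ {b = b} {t} {c - t} (fromℤ (x 0F) , λ k → ≋⇒≡-mod (≋-refl {pow p k} {t}))
               (lift-unit-residue (tail b) (tail x) (≋-subˡ t (form (tail b) (tail x)) h) p∤c-t))
        where
        t = b 0F * x 0F * x 0F
        regroup : ∀ c t → t + (c - t) ≡ c
        regroup = solve-∀
        p∤c-t : ¬ + p ∣ c - t
        p∤c-t p∣c-t = p∤c (subst (+ p ∣_) (cancel c t) (∣m∣n⇒∣m+n p∣c-t (∣m⇒∣m*n (x 0F) p∣b₀x₀)))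
          where
          cancel : ∀ c t → c - t + t ≡ c
          cancel = solve-∀

      p-multiple-root : ∀ q s {n} → ¬ + p ∣ q * s → + p * q * s * s ≋ n [mod pow p 2 ] →
        UnaryRep p (+ p * q) (cst n)
      p-multiple-root q s {n} p∤qs pqss≋n with ≋-∣ (≋-weaken p∣p² pqss≋n) p∣pqss
        where
        p∣pqss : + p ∣ + p * q * s * s
        p∣pqss = ∣m⇒∣m*n s (∣m⇒∣m*n s (∣m⇒∣m*n q ∣-refl))
      ... | divides n′ refl = y , λ k → ≋⇒≡-mod (scaled k)
        where
        factor : ∀ p q s n′ → p * q * s * s - n′ * p ≡ p * (q * s * s - n′)
        factor = solve-∀
        root : q * s * s ≋ n′ [mod + p ]
        root = congruent (p²∣⇒p∣ (subst (pow p 2 ∣_) (factor (+ p) q s n′) (∣difference pqss≋n)))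
        lifted = hensel q (fromℤ n′) s p∤qs root
        y = proj₁ lifted
        y-root : ∀ k → q * digit y k * digit y k ≋ n′ [mod pow p k ]
        y-root k = ≡-mod⇒≋ (proj₂ lifted k)
        regroup : ∀ p q y → p * q * y * y ≡ p * (q * y * y)
        regroup = solve-∀
        scaled : ∀ k → + p * q * digit y k * digit y k ≋ n′ * + p [mod pow p k ]
        scaled k = begin
          + p * q * digit y k * digit y k   ≡⟨ regroup (+ p) q (digit y k) ⟩
          + p * (q * digit y k * digit y k) ≈⟨ *-congˡ-≋ (+ p) (y-root k) ⟩
          + p * n′                          ≡⟨ ℤ.*-comm (+ p) n′ ⟩
          n′ * + p                          ∎
          where open ≋-Reasoning (pow p k)

      avoid-root : ¬ + p ∣ + 3 → ∀ {c} d → ¬ + p ∣ c → Σ ℤ λ σ → ¬ + p ∣ σ × ¬ + p ∣ c * σ * σ + d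
      avoid-root p∤3 {c} d p∤c with + p ∣? (c * + 1 * + 1 + d)
      ... | no p∤c+d = + 1 , ∤-1 , p∤c+d
      ... | yes p∣c+d = + 2 , p∤2 ,
            λ p∣4c+d → ∤-* p∤3 p∤c (subst (+ p ∣_) (difference c d) (∣m∣n⇒∣m-n p∣4c+d p∣c+d))
        where
        difference : ∀ c d → c * + 2 * + 2 + d - (c * + 1 * + 1 + d) ≡ + 3 * c
        difference = solve-∀

      module Nonresidue (Δ : ℤ[ p ]) (Δ-unit : IsUnit p Δ) (Δ-nonsquare : ¬ IsSquare p Δ) where

        Δ₁ : ℤ
        Δ₁ = digit Δ 1

        p∤Δ₁ : ¬ + p ∣ Δ₁
        p∤Δ₁ = unit-digit {Δ} Δ-unit 0

        nonresidue : ∀ z → ¬ z * z ≋ Δ₁ [mod + p ]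
        nonresidue z zz≋Δ₁ = Δ-nonsquare (proj₁ lifted , λ k → ≋⇒≡-mod (square k))
          where
          p∤1z : ¬ + p ∣ + 1 * z
          p∤1z p∣z = p∤Δ₁ (≋-∣ zz≋Δ₁ (∣m⇒∣m*n z (subst (+ p ∣_) (ℤ.*-identityˡ z) p∣z)))
          lifted = hensel (+ 1) Δ z p∤1z (≋-trans (≡⇒≋ (cong (_* z) (ℤ.*-identityˡ z))) zz≋Δ₁)
          y = proj₁ lifted
          square : ∀ k → digit y k * digit y k ≋ digit Δ k [mod pow p k ]
          square k = ≋-trans (≡⇒≋ (cong (_* digit y k) (sym (ℤ.*-identityˡ (digit y k)))))
                             (≡-mod⇒≋ (proj₂ lifted k))

        nonresidue-scaled : ∀ {x} y → ¬ + p ∣ x → ¬ y * y ≋ Δ₁ * x * x [mod + p ]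
        nonresidue-scaled {x} y p∤x yy≋Δ₁xx = nonresidue (y * w) (begin
          y * w * (y * w)        ≡⟨ regroup₁ y w ⟩
          y * y * (w * w)        ≈⟨ *-congʳ-≋ (w * w) yy≋Δ₁xx ⟩
          Δ₁ * x * x * (w * w)   ≡⟨ regroup₂ Δ₁ x w ⟩
          Δ₁ * (x * w * (x * w)) ≈⟨ *-congˡ-≋ Δ₁ (*-cong-≋ xw≋1 xw≋1) ⟩
          Δ₁ * (+ 1 * + 1)       ≡⟨ ℤ.*-identityʳ Δ₁ ⟩
          Δ₁                     ∎)
          where
          open ≋-Reasoning (+ p)
          w = proj₁ (inverse p∤x)
          xw≋1 = proj₂ (inverse p∤x)
          regroup₁ : ∀ y w → y * w * (y * w) ≡ y * y * (w * w)
          regroup₁ = solve-∀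
          regroup₂ : ∀ Δ₁ x w → Δ₁ * x * x * (w * w) ≡ Δ₁ * (x * w * (x * w))
          regroup₂ = solve-∀

        anisotropic : ∀ a b D → a * b * D * D ≋ - Δ₁ [mod + p ] →
          ∀ x y → a * x * x + b * y * y ≋ + 0 [mod + p ] → pow p 2 ∣ a * x * x + b * y * y
        anisotropic a b D abDD≋-Δ₁ x y form≋0 = ∣m∣n⇒∣m+n (p²∣ a p∣x) (p²∣ b p∣y)
          where
          p²∣ : ∀ c {z} → + p ∣ z → pow p 2 ∣ c * z * z
          p²∣ c {z} p∣z = subst (pow p 2 ∣_) (sym (ℤ.*-assoc c z z)) (∣n⇒∣m*n c (p∣⇒p²∣square p∣z))
          byy≋-axx : b * y * y ≋ - (a * x * x) [mod + p ]
          byy≋-axx = ≋-trans (≋-subˡ (a * x * x) (b * y * y) form≋0) (≡⇒≋ (ℤ.+-identityˡ (- (a * x * x))))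
          regroup₁ : ∀ b y D → b * y * D * (b * y * D) ≡ b * D * D * (b * y * y)
          regroup₁ = solve-∀
          regroup₂ : ∀ a b D x → b * D * D * - (a * x * x) ≡ - (a * b * D * D) * (x * x)
          regroup₂ = solve-∀
          regroup₃ : ∀ Δ₁ x → - - Δ₁ * (x * x) ≡ Δ₁ * x * x
          regroup₃ = solve-∀
          p∣x : + p ∣ x
          p∣x with + p ∣? x
          ... | yes p∣x = p∣x
          ... | no p∤x = ⊥-elim (nonresidue-scaled (b * y * D) p∤x (begin
            b * y * D * (b * y * D)     ≡⟨ regroup₁ b y D ⟩
            b * D * D * (b * y * y)     ≈⟨ *-congˡ-≋ (b * D * D) byy≋-axx ⟩
            b * D * D * - (a * x * x)   ≡⟨ regroup₂ a b D x ⟩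
            - (a * b * D * D) * (x * x) ≈⟨ *-congʳ-≋ (x * x) (-‿cong-≋ abDD≋-Δ₁) ⟩
            - - Δ₁ * (x * x)            ≡⟨ regroup₃ Δ₁ x ⟩
            Δ₁ * x * x                  ∎))
            where open ≋-Reasoning (+ p)
          p∤b : ¬ + p ∣ b
          p∤b p∣b = p∤Δ₁ (∣-m⇒∣m (≋-∣ abDD≋-Δ₁ (∣m⇒∣m*n D (∣m⇒∣m*n D (∣n⇒∣m*n a p∣b)))))
          p∣y : + p ∣ y
          p∣y = ∣-square {y} ([ ⊥-elim ∘ p∤b , id ]′ (euclid {b} {y * y} (subst (+ p ∣_) (ℤ.*-assoc b y y)
            (≋-∣ (≋-sym byy≋-axx) (∣m⇒∣-m (∣m⇒∣m*n x (∣n⇒∣m*n a p∣x)))))))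

  -- Determinants

  -- INLINE lets the ring solver see through det₃.
  det₃ : ℤ → ℤ → ℤ → ℤ → ℤ → ℤ → ℤ → ℤ → ℤ → ℤ
  det₃ a b c d e f g h i = a * (e * i - f * h) - b * (d * i - f * g) + c * (d * h - e * g)
  {-# INLINE det₃ #-}

  Matrix₃ : Set
  Matrix₃ = Fin 3 → Fin 3 → ℤ

  det : Matrix₃ → ℤ
  det M = det₃ (M 0F 0F) (M 0F 1F) (M 0F 2F) (M 1F 0F) (M 1F 1F) (M 1F 2F) (M 2F 0F) (M 2F 1F) (M 2F 2F)

  gram : (Fin 3 → ℤ) → Matrix₃ → Matrix₃
  gram a t i j = a 0F * t 0F i * t 0F j + a 1F * t 1F i * t 1F j + a 2F * t 2F i * t 2F j

  det-gram : ∀ a t → det (gram a t) ≡ a 0F * a 1F * a 2F * (det t * det t)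
  det-gram a t = identity (a 0F) (a 1F) (a 2F)
    (t 0F 0F) (t 0F 1F) (t 0F 2F) (t 1F 0F) (t 1F 1F) (t 1F 2F) (t 2F 0F) (t 2F 1F) (t 2F 2F)
    where
    identity : ∀ a₀ a₁ a₂ t₀₀ t₀₁ t₀₂ t₁₀ t₁₁ t₁₂ t₂₀ t₂₁ t₂₂ →
      let B : ℤ → ℤ → ℤ → ℤ → ℤ → ℤ → ℤ
          B x₀ x₁ x₂ y₀ y₁ y₂ = a₀ * x₀ * y₀ + a₁ * x₁ * y₁ + a₂ * x₂ * y₂
      in det₃ (B t₀₀ t₁₀ t₂₀ t₀₀ t₁₀ t₂₀) (B t₀₀ t₁₀ t₂₀ t₀₁ t₁₁ t₂₁) (B t₀₀ t₁₀ t₂₀ t₀₂ t₁₂ t₂₂)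
              (B t₀₁ t₁₁ t₂₁ t₀₀ t₁₀ t₂₀) (B t₀₁ t₁₁ t₂₁ t₀₁ t₁₁ t₂₁) (B t₀₁ t₁₁ t₂₁ t₀₂ t₁₂ t₂₂)
              (B t₀₂ t₁₂ t₂₂ t₀₀ t₁₀ t₂₀) (B t₀₂ t₁₂ t₂₂ t₀₁ t₁₁ t₂₁) (B t₀₂ t₁₂ t₂₂ t₀₂ t₁₂ t₂₂)
         ≡ a₀ * a₁ * a₂ * (det₃ t₀₀ t₀₁ t₀₂ t₁₀ t₁₁ t₁₂ t₂₀ t₂₁ t₂₂ * det₃ t₀₀ t₀₁ t₀₂ t₁₀ t₁₁ t₁₂ t₂₀ t₂₁ t₂₂)
    identity = solve-∀

  det-cong : ∀ {m} {M N : Matrix₃} → (∀ i j → M i j ≋ N i j [mod m ]) → det M ≋ det N [mod m ]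
  det-cong M≋N = +-cong-≋
    (−-cong-≋ (*-cong-≋ (M≋N 0F 0F) (−-cong-≋ (*-cong-≋ (M≋N 1F 1F) (M≋N 2F 2F)) (*-cong-≋ (M≋N 1F 2F) (M≋N 2F 1F))))
              (*-cong-≋ (M≋N 0F 1F) (−-cong-≋ (*-cong-≋ (M≋N 1F 0F) (M≋N 2F 2F)) (*-cong-≋ (M≋N 1F 2F) (M≋N 2F 0F)))))
    (*-cong-≋ (M≋N 0F 2F) (−-cong-≋ (*-cong-≋ (M≋N 1F 0F) (M≋N 2F 1F)) (*-cong-≋ (M≋N 1F 1F) (M≋N 2F 0F))))

  det-diag : ∀ (d : Fin 3 → Seq) k → det (λ i j → diag d i j k) ≡ d 0F k * d 1F k * d 2F k
  det-diag d k = identity (d 0F k) (d 1F k) (d 2F k)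
    where
    identity : ∀ x y z →
      det₃ (x * + 1) (x * + 0) (x * + 0) (y * + 0) (y * + 1) (y * + 0) (z * + 0) (z * + 0) (z * + 1) ≡ x * y * z
    identity = solve-∀

  gram-∑ : ∀ {p} (a₀ a₁ a₂ : ℤ) (T : Mat p 3) i j k →
    ∑ (λ r → ∑ (λ s → digit (T r i) ⊗ diag (vec3 (cst a₀) (cst a₁) (cst a₂)) r s ⊗ digit (T s j))) k
      ≡ gram (vec3 a₀ a₁ a₂) (λ r s → digit (T r s) k) i j
  gram-∑ a₀ a₁ a₂ T i j k = identity a₀ a₁ a₂ (digit (T 0F i) k) (digit (T 1F i) k) (digit (T 2F i) k)
                                              (digit (T 0F j) k) (digit (T 1F j) k) (digit (T 2F j) k)
    where
    identity : ∀ a₀ a₁ a₂ x₀ x₁ x₂ y₀ y₁ y₂ →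
        x₀ * (a₀ * + 1) * y₀ + (x₀ * (a₀ * + 0) * y₁ + (x₀ * (a₀ * + 0) * y₂ + + 0))
      + ((x₁ * (a₁ * + 0) * y₀ + (x₁ * (a₁ * + 1) * y₁ + (x₁ * (a₁ * + 0) * y₂ + + 0)))
      + ((x₂ * (a₂ * + 0) * y₀ + (x₂ * (a₂ * + 0) * y₁ + (x₂ * (a₂ * + 1) * y₂ + + 0))) + + 0))
      ≡ a₀ * x₀ * y₀ + a₁ * x₁ * y₁ + a₂ * x₂ * y₂
    identity = solve-∀

  -- The construction of v

  pos-scaled-square : ∀ a α → + (a ℕ.* α ℕ.^ 2) ≡ + a * + α * + α
  pos-scaled-square a α = begin
    + (a ℕ.* α ℕ.^ 2)         ≡⟨ ℤ.pos-* a (α ℕ.^ 2) ⟩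
    + a * + (α ℕ.* (α ℕ.* 1)) ≡⟨ cong (λ t → + a * + (α ℕ.* t)) (ℕ.*-identityʳ α) ⟩
    + a * + (α ℕ.* α)         ≡⟨ cong (+ a *_) (ℤ.pos-* α α) ⟩
    + a * (+ α * + α)         ≡⟨ ℤ.*-assoc (+ a) (+ α) (+ α) ⟨
    + a * + α * + α           ∎
    where open ≡-Reasoning

  module Witness {p : ℕ} (p-prime : Prime p) (3<p : 3 < p) (u : ℕ) (u⊥p : Coprime u p)
    (a₁ a₂ a₃ α₁ α₂ α₃ : ℕ) (Δ : ℤ[ p ]) (Δ-unit : IsUnit p Δ) (Δ-nonsquare : ¬ IsSquare p Δ) where

    open PrimeModulus p-prime

    private instance
      p≢0 : ℕ.NonZero p
      p≢0 = prime⇒nonZero p-prime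
      p²≢0 : ℕ.NonZero (p ℕ.^ 2)
      p²≢0 = ℕ.m^n≢0 p 2

    p∤2 : ¬ + p ∣ + 2
    p∤2 = ∤-small (s≤s z≤n) (ℕ.<-trans (ℕ.n<1+n 2) 3<p)

    p∤3 : ¬ + p ∣ + 3
    p∤3 = ∤-small (s≤s z≤n) 3<p

    open OddPrime p∤2
    open Nonresidue Δ Δ-unit Δ-nonsquare

    A₁ A₂ A₃ : ℤ
    A₁ = + a₁
    A₂ = + a₂
    A₃ = + a₃

    S T₃ : ℤ
    S = A₁ * + α₁ * + α₁ + A₂ * + α₂ * + α₂
    T₃ = A₃ * + α₃ * + α₃

    N M : ℕ → ℕ
    N v = u ℕ.* v ℕ.+ a₁ ℕ.* α₁ ℕ.^ 2 ℕ.+ a₂ ℕ.* α₂ ℕ.^ 2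
    M v = N v ℕ.+ a₃ ℕ.* α₃ ℕ.^ 2

    N-cast : ∀ v → + N v ≡ + u * + v + S
    N-cast v = begin
      + N v
        ≡⟨ ℤ.pos-+ (u ℕ.* v ℕ.+ a₁ ℕ.* α₁ ℕ.^ 2) (a₂ ℕ.* α₂ ℕ.^ 2) ⟩
      + (u ℕ.* v ℕ.+ a₁ ℕ.* α₁ ℕ.^ 2) + + (a₂ ℕ.* α₂ ℕ.^ 2)
        ≡⟨ cong₂ _+_ (ℤ.pos-+ (u ℕ.* v) (a₁ ℕ.* α₁ ℕ.^ 2)) (pos-scaled-square a₂ α₂) ⟩
      + (u ℕ.* v) + + (a₁ ℕ.* α₁ ℕ.^ 2) + A₂ * + α₂ * + α₂
        ≡⟨ cong₂ (λ x y → x + y + A₂ * + α₂ * + α₂) (ℤ.pos-* u v) (pos-scaled-square a₁ α₁) ⟩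
      + u * + v + A₁ * + α₁ * + α₁ + A₂ * + α₂ * + α₂
        ≡⟨ ℤ.+-assoc (+ u * + v) (A₁ * + α₁ * + α₁) (A₂ * + α₂ * + α₂) ⟩
      + u * + v + S
        ∎
      where open ≡-Reasoning

    M-cast : ∀ v → + M v ≡ + N v + T₃
    M-cast v = trans (ℤ.pos-+ (N v) (a₃ ℕ.* α₃ ℕ.^ 2)) (cong (λ t → + N v + t) (pos-scaled-square a₃ α₃))

    Conclusion : Set
    Conclusion = Σ ℕ λ v → 0 < v × v < p ℕ.^ 2 ×
      ¬ RepZp p (vec2 A₁ A₂) (+ N v) × RepZp p (vec3 A₁ A₂ A₃) (+ M v) ×
      Σ ℕ (λ k₁ → Σ ℕ λ k₂ → Ord p (N v) k₁ × Ord p (M v) k₂ × k₁ ⊔ k₂ ≤ 1)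

    conclude : ∀ v {k₁ k₂} → v < p ℕ.^ 2 → ¬ RepZp p (vec2 A₁ A₂) (+ N v) → RepZp p (vec3 A₁ A₂ A₃) (+ M v) →
      Ord p (N v) k₁ → Ord p (M v) k₂ → k₁ ⊔ k₂ ≤ 1 → Conclusion
    -- v = 0 is excluded by non-representability: N 0 = a₁α₁² + a₂α₂².
    conclude zero _ ¬rep = ⊥-elim (¬rep (subst (RepZp p (vec2 A₁ A₂)) N₀≡
      (form-represented (vec2 A₁ A₂) (vec2 (+ α₁) (+ α₂)))))
      where
      regroup : ∀ u x y → x + (y + + 0) ≡ u * + 0 + (x + y)
      regroup = solve-∀
      N₀≡ : form (vec2 A₁ A₂) (vec2 (+ α₁) (+ α₂)) ≡ + N 0
      N₀≡ = trans (regroup (+ u) (A₁ * + α₁ * + α₁) (A₂ * + α₂ * + α₂)) (sym (N-cast 0))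
    conclude (suc v) {k₁} {k₂} v<p² ¬rep rep ord₁ ord₂ k≤1 =
      suc v , s≤s z≤n , v<p² , ¬rep , rep , k₁ , k₂ , ord₁ , ord₂ , k≤1

    retarget : ∀ t → Σ ℕ λ v → v < p ℕ.^ 2 × + N v ≋ t [mod pow p 2 ] × + M v ≋ t + T₃ [mod pow p 2 ]
    retarget t = v , proj₁ (proj₂ solution) , N≋t , ≋-trans (≡⇒≋ (M-cast v)) (+-congʳ-≋ T₃ N≋t)
      where
      solution = solve-linear (coprime-^ u⊥p 2) (t - S)
      v = proj₁ solution
      cancel : ∀ t S → t - S + S ≡ t
      cancel = solve-∀
      N≋t : + N v ≋ t [mod pow p 2 ]
      N≋t = ≋-trans (≡⇒≋ (N-cast v)) (≋-trans (+-congʳ-≋ S (proj₂ (proj₂ solution))) (≡⇒≋ (cancel t S)))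

    module ThirdIsUnit (b : ℤ) (p∤b : ¬ + p ∣ b) (p∤A₃ : ¬ + p ∣ A₃)
      (reduce : ∀ x → Σ ℤ λ y → form (vec2 A₁ A₂) x ≋ b * y * y [mod + p ])
      (embed : ∀ y z → Σ (Fin 3 → ℤ) λ x → form (vec3 A₁ A₂ A₃) x ≡ b * y * y + A₃ * z * z) where

      σ-choice = avoid-root p∤3 T₃ (∤-* p∤b p∤Δ₁)
      σ = proj₁ σ-choice
      p∤σ = proj₁ (proj₂ σ-choice)

      t : ℤ
      t = b * Δ₁ * σ * σ

      choice = retarget t
      v = proj₁ choice

      N≋t : + N v ≋ t [mod + p ]
      N≋t = ≋-weaken p∣p² (proj₁ (proj₂ (proj₂ choice)))

      M≋t+T₃ : + M v ≋ t + T₃ [mod + p ]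
      M≋t+T₃ = ≋-weaken p∣p² (proj₂ (proj₂ (proj₂ choice)))

      p∤N : ¬ + p ∣ + N v
      p∤N p∣N = ∤-* (∤-* (∤-* p∤b p∤Δ₁) p∤σ) p∤σ (≋-∣ N≋t p∣N)

      p∤M : ¬ + p ∣ + M v
      p∤M p∣M = proj₂ (proj₂ σ-choice) (≋-∣ M≋t+T₃ p∣M)

      ¬rep : ¬ RepZp p (vec2 A₁ A₂) (+ N v)
      ¬rep r = nonresidue-scaled y p∤σ (cancel-≋ p∤b (begin
        b * (y * y)        ≡⟨ ℤ.*-assoc b y y ⟨
        b * y * y          ≈⟨ ≋-sym (proj₂ (reduce x)) ⟩
        form (vec2 A₁ A₂) x ≈⟨ ≋-weaken (p∣pow-suc p 0) (proj₂ (RepZp⇒residue (vec2 A₁ A₂) (+ N v) r 1)) ⟩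
        + N v              ≈⟨ N≋t ⟩
        b * Δ₁ * σ * σ     ≡⟨ regroup b Δ₁ σ ⟩
        b * (Δ₁ * σ * σ)   ∎))
        where
        open ≋-Reasoning (+ p)
        x = proj₁ (RepZp⇒residue (vec2 A₁ A₂) (+ N v) r 1)
        y = proj₁ (reduce x)
        regroup : ∀ b Δ₁ σ → b * Δ₁ * σ * σ ≡ b * (Δ₁ * σ * σ)
        regroup = solve-∀

      rep : RepZp p (vec3 A₁ A₂ A₃) (+ M v)
      rep = lift-unit-residue (vec3 A₁ A₂ A₃) (proj₁ (embed y z)) (≋-trans (≡⇒≋ (proj₂ (embed y z))) yz≋M) p∤M
        where
        yz = sum-of-squares (+ M v) p∤b p∤A₃
        y = proj₁ yz
        z = proj₁ (proj₂ yz)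
        yz≋M = proj₂ (proj₂ yz)

      result : Conclusion
      result = conclude v {0} {0} (proj₁ (proj₂ choice)) ¬rep rep (ord-zero p∤N) (ord-zero p∤M) z≤n

    case-p∣a₁ : + p ∣ A₁ × ¬ + p ∣ A₂ × ¬ + p ∣ A₃ → Conclusion
    case-p∣a₁ (p∣A₁ , p∤A₂ , p∤A₃) = ThirdIsUnit.result A₂ p∤A₂ p∤A₃ reduce embed
      where
      drop : ∀ a t → a + (t + + 0) ≡ a + t
      drop = solve-∀
      reduce : ∀ x → Σ ℤ λ y → form (vec2 A₁ A₂) x ≋ A₂ * y * y [mod + p ]
      reduce x = x 1F , ≋-trans (+-congʳ-≋ (A₂ * x 1F * x 1F + + 0) A₁x₀x₀≋0)
                                (≡⇒≋ (trans (drop (+ 0) (A₂ * x 1F * x 1F)) (ℤ.+-identityˡ (A₂ * x 1F * x 1F))))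
        where
        A₁x₀x₀≋0 = ∣⇒≋0 (∣m⇒∣m*n (x 0F) (∣m⇒∣m*n (x 0F) p∣A₁))
      embed : ∀ y z → Σ (Fin 3 → ℤ) λ x → form (vec3 A₁ A₂ A₃) x ≡ A₂ * y * y + A₃ * z * z
      embed y z = vec3 (+ 0) y z , identity A₁ A₂ A₃ y z
        where
        identity : ∀ a₁ a₂ a₃ y z → a₁ * + 0 * + 0 + (a₂ * y * y + (a₃ * z * z + + 0)) ≡ a₂ * y * y + a₃ * z * z
        identity = solve-∀

    case-p∣a₂ : ¬ + p ∣ A₁ × + p ∣ A₂ × ¬ + p ∣ A₃ → Conclusion
    case-p∣a₂ (p∤A₁ , p∣A₂ , p∤A₃) = ThirdIsUnit.result A₁ p∤A₁ p∤A₃ reduce embed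
      where
      drop : ∀ a → a + (+ 0 + + 0) ≡ a
      drop = solve-∀
      reduce : ∀ x → Σ ℤ λ y → form (vec2 A₁ A₂) x ≋ A₁ * y * y [mod + p ]
      reduce x = x 0F , ≋-trans (+-congˡ-≋ (A₁ * x 0F * x 0F) (+-congʳ-≋ (+ 0) A₂x₁x₁≋0))
                                (≡⇒≋ (drop (A₁ * x 0F * x 0F)))
        where
        A₂x₁x₁≋0 = ∣⇒≋0 (∣m⇒∣m*n (x 1F) (∣m⇒∣m*n (x 1F) p∣A₂))
      embed : ∀ y z → Σ (Fin 3 → ℤ) λ x → form (vec3 A₁ A₂ A₃) x ≡ A₁ * y * y + A₃ * z * z
      embed y z = vec3 y (+ 0) z , identity A₁ A₂ A₃ y z
        where
        identity : ∀ a₁ a₂ a₃ y z → a₁ * y * y + (a₂ * + 0 * + 0 + (a₃ * z * z + + 0)) ≡ a₁ * y * y + a₃ * z * z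
        identity = solve-∀

    module ThirdDivisible (p∣A₃ : + p ∣ A₃) (p²∤A₃ : ¬ pow p 2 ∣ A₃) (D : ℤ)
      (binary-discriminant : A₁ * A₂ * D * D ≋ - Δ₁ [mod + p ]) where

      q : ℤ
      q = _∣_.quotient p∣A₃

      A₃≡pq : A₃ ≡ + p * q
      A₃≡pq = trans (_∣_.equality p∣A₃) (ℤ.*-comm q (+ p))

      p∤q : ¬ + p ∣ q
      p∤q p∣q = p²∤A₃ (subst (pow p 2 ∣_) (sym A₃≡pq)
                              (subst (_∣ + p * q) (sym (pow-2 p)) (∣-*-∣ (∣-refl {+ p}) p∣q)))

      τ-choice = avoid-root p∤3 (- (+ α₃ * + α₃)) ∤-1
      τ = proj₁ τ-choice
      p∤τ = proj₁ (proj₂ τ-choice)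

      choice = retarget (A₃ * τ * τ - T₃)
      v = proj₁ choice

      N≋ : + N v ≋ + p * (q * (+ 1 * τ * τ + - (+ α₃ * + α₃))) [mod pow p 2 ]
      N≋ = ≋-trans (proj₁ (proj₂ (proj₂ choice))) (≡⇒≋ (trans (cong (λ c → c * τ * τ - c * + α₃ * + α₃) A₃≡pq)
                                                               (regroup (+ p) q τ (+ α₃))))
        where
        regroup : ∀ p q τ α → p * q * τ * τ - p * q * α * α ≡ p * (q * (+ 1 * τ * τ + - (α * α)))
        regroup = solve-∀

      M≋ : + M v ≋ + p * (q * τ * τ) [mod pow p 2 ]
      M≋ = ≋-trans (proj₂ (proj₂ (proj₂ choice)))
        (≡⇒≋ (trans (cong (λ c → c * τ * τ - c * + α₃ * + α₃ + c * + α₃ * + α₃) A₃≡pq)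
                                                                (regroup (+ p) q τ (+ α₃))))
        where
        regroup : ∀ p q τ α → p * q * τ * τ - p * q * α * α + p * q * α * α ≡ p * (q * τ * τ)
        regroup = solve-∀

      N-exact : + p ∣ + N v × ¬ pow p 2 ∣ + N v
      N-exact = exactly-p N≋ (∤-* p∤q (proj₂ (proj₂ τ-choice)))

      M-exact : + p ∣ + M v × ¬ pow p 2 ∣ + M v
      M-exact = exactly-p M≋ (∤-* (∤-* p∤q p∤τ) p∤τ)

      ¬rep : ¬ RepZp p (vec2 A₁ A₂) (+ N v)
      ¬rep r = proj₂ N-exact (≋-∣ form≋N (subst (pow p 2 ∣_) (drop (A₁ * x 0F * x 0F) (A₂ * x 1F * x 1F))
                                          (anisotropic A₁ A₂ D binary-discriminant (x 0F) (x 1F) form≋0)))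
        where
        x = proj₁ (RepZp⇒residue (vec2 A₁ A₂) (+ N v) r 2)
        form≋N : form (vec2 A₁ A₂) x ≋ + N v [mod pow p 2 ]
        form≋N = proj₂ (RepZp⇒residue (vec2 A₁ A₂) (+ N v) r 2)
        drop : ∀ s t → s + t ≡ s + (t + + 0)
        drop = solve-∀
        form≋0 : A₁ * x 0F * x 0F + A₂ * x 1F * x 1F ≋ + 0 [mod + p ]
        form≋0 = ≋-trans (≡⇒≋ (drop (A₁ * x 0F * x 0F) (A₂ * x 1F * x 1F)))
                         (≋-trans (≋-weaken p∣p² form≋N) (∣⇒≋0 (proj₁ N-exact)))

      rep : RepZp p (vec3 A₁ A₂ A₃) (+ M v)
      rep = RepZp-third A₁ A₂ A₃ (+ M v) (subst (λ c → UnaryRep p c (cst (+ M v))) (sym A₃≡pq)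
                          (p-multiple-root q τ (∤-* p∤q p∤τ) (≋-trans (≡⇒≋ (regroup (+ p) q τ)) (≋-sym M≋))))
        where
        regroup : ∀ p q τ → p * q * τ * τ ≡ p * (q * τ * τ)
        regroup = solve-∀

      result : Conclusion
      result = conclude v {1} {1} (proj₁ (proj₂ choice)) ¬rep rep
        (ord-one (proj₁ N-exact) (proj₂ N-exact)) (ord-one (proj₁ M-exact) (proj₂ M-exact)) ℕ.≤-refl

    module Isometry (ε : ℤ[ p ]) (ε-unit : IsUnit p ε) (T : Mat p 3)
      (TᵗGT≈H : ∀ i j →
        ∑ (λ k → ∑ (λ l → digit (T k i) ⊗ diag (vec3 (cst A₁) (cst A₂) (cst A₃)) k l ⊗ digit (T l j)))
          ≈[ p ] diag (vec3 (cst (+ 1)) (⊖ digit Δ) (cst (+ p) ⊗ digit ε)) i j) where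

      H : Fin 3 → Fin 3 → Seq
      H = diag (vec3 (cst (+ 1)) (⊖ digit Δ) (cst (+ p) ⊗ digit ε))

      t : Matrix₃
      t i j = digit (T i j) 2

      gram≋H : ∀ i j → gram (vec3 A₁ A₂ A₃) t i j ≋ H i j 2 [mod pow p 2 ]
      gram≋H i j = ≋-trans (≡⇒≋ (sym (gram-∑ A₁ A₂ A₃ T i j 2))) (≡-mod⇒≋ (TᵗGT≈H i j 2))

      discriminant : A₁ * A₂ * A₃ * (det t * det t) ≋ + p * (- digit Δ 2 * digit ε 2) [mod pow p 2 ]
      discriminant = begin
        A₁ * A₂ * A₃ * (det t * det t)    ≡⟨ det-gram (vec3 A₁ A₂ A₃) t ⟨
        det (gram (vec3 A₁ A₂ A₃) t)      ≈⟨ det-cong gram≋H ⟩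
        det (λ i j → H i j 2)             ≡⟨ det-diag (vec3 (cst (+ 1)) (⊖ digit Δ) (cst (+ p) ⊗ digit ε)) 2 ⟩
        + 1 * - digit Δ 2 * (+ p * digit ε 2) ≡⟨ regroup (+ p) (digit Δ 2) (digit ε 2) ⟩
        + p * (- digit Δ 2 * digit ε 2)   ∎
        where
        open ≋-Reasoning (pow p 2)
        regroup : ∀ P d e → + 1 * - d * (P * e) ≡ P * (- d * e)
        regroup = solve-∀

      discriminant-exactly-p : + p ∣ A₁ * A₂ * A₃ × ¬ pow p 2 ∣ A₁ * A₂ * A₃
      discriminant-exactly-p = exactly-p-of-scaled {d = det t} discriminant
        (∤-* (λ p∣-Δ₂ → unit-digit {Δ} Δ-unit 1 (∣-m⇒∣m p∣-Δ₂)) (unit-digit {ε} ε-unit 1))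

      D : ℤ
      D = t 0F 0F * t 1F 1F - t 0F 1F * t 1F 0F

      binary-discriminant : + p ∣ A₃ → A₁ * A₂ * D * D ≋ - Δ₁ [mod + p ]
      binary-discriminant p∣A₃ = begin
        A₁ * A₂ * D * D                               ≡⟨ identity A₁ A₂ (t 0F 0F) (t 0F 1F) (t 1F 0F) (t 1F 1F) ⟩
        Q 0F 0F * Q 1F 1F - Q 0F 1F * Q 0F 1F         ≈⟨ −-cong-≋ (*-cong-≋ (Q≋H 0F 0F) (Q≋H 1F 1F))
                                                                  (*-cong-≋ (Q≋H 0F 1F) (Q≋H 0F 1F)) ⟩
        + 1 * + 1 * (- digit Δ 2 * + 1) - + 1 * + 0 * (+ 1 * + 0) ≡⟨ simplify (digit Δ 2) ⟩
        - digit Δ 2                                   ≈⟨ -‿cong-≋ (digit-≋ Δ 1) ⟩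
        - Δ₁                                          ∎
        where
        open ≋-Reasoning (+ p)
        Q : Fin 3 → Fin 3 → ℤ
        Q i j = A₁ * t 0F i * t 0F j + A₂ * t 1F i * t 1F j
        Q≋H : ∀ i j → Q i j ≋ H i j 2 [mod + p ]
        Q≋H i j = ≋-trans (≋-sym (+-∣-≋ (Q i j) (∣m⇒∣m*n (t 2F j) (∣m⇒∣m*n (t 2F i) p∣A₃))))
                          (≋-weaken p∣p² (gram≋H i j))
        identity : ∀ a b x₀ x₁ y₀ y₁ → a * b * (x₀ * y₁ - x₁ * y₀) * (x₀ * y₁ - x₁ * y₀)
          ≡ (a * x₀ * x₀ + b * y₀ * y₀) * (a * x₁ * x₁ + b * y₁ * y₁)
            - (a * x₀ * x₁ + b * y₀ * y₁) * (a * x₀ * x₁ + b * y₀ * y₁)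
        identity = solve-∀
        simplify : ∀ d → + 1 * + 1 * (- d * + 1) - + 1 * + 0 * (+ 1 * + 0) ≡ - d
        simplify = solve-∀

      case-p∣a₃ : + p ∣ A₃ × ¬ pow p 2 ∣ A₃ → Conclusion
      case-p∣a₃ (p∣A₃ , p²∤A₃) = ThirdDivisible.result p∣A₃ p²∤A₃ D (binary-discriminant p∣A₃)

open import Defs
open import Data.Nat using (ℕ; _+_; _*_; _^_; _<_; _≤_; _⊔_)
open import Data.Nat.Primality using (Prime)
open import Data.Nat.Coprimality using (Coprime)
open import Data.Integer using (+_)
open import Data.Product using (Σ; _×_; ∃)
open import Relation.Nullary using (¬_)
open import Data.Product using (_,_)
open import Data.Sum using ([_,_]′)

lemma2p4 : (p : ℕ) → Prime p → 3 < p →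
  (u : ℕ) → 0 < u → Coprime u p →
  (a₁ a₂ a₃ α₁ α₂ α₃ : ℕ) →
  0 < a₁ → 0 < a₂ → 0 < a₃ → 0 < α₁ → 0 < α₂ → 0 < α₃ →
  (Δ : ℤ[ p ]) → IsUnit p Δ → ¬ IsSquare p Δ →
  Σ ℤ[ p ] (λ ε → IsUnit p ε ×
    IsometricZp p (diag (vec3 (cst (+ a₁)) (cst (+ a₂)) (cst (+ a₃))))
                  (diag (vec3 (cst (+ 1)) (⊖ digit Δ) (cst (+ p) ⊗ digit ε)))) →
  Σ ℕ λ v → 0 < v × v < p ^ 2 ×
    ¬ RepZp p (vec2 (+ a₁) (+ a₂)) (+ (u * v + a₁ * α₁ ^ 2 + a₂ * α₂ ^ 2)) ×
    RepZp p (vec3 (+ a₁) (+ a₂) (+ a₃))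
      (+ (u * v + a₁ * α₁ ^ 2 + a₂ * α₂ ^ 2 + a₃ * α₃ ^ 2)) ×
    Σ ℕ (λ k₁ → Σ ℕ λ k₂ →
      Ord p (u * v + a₁ * α₁ ^ 2 + a₂ * α₂ ^ 2) k₁ ×
      Ord p (u * v + a₁ * α₁ ^ 2 + a₂ * α₂ ^ 2 + a₃ * α₃ ^ 2) k₂ ×
      k₁ ⊔ k₂ ≤ 1)
lemma2p4 p p-prime 3<p u _ u⊥p a₁ a₂ a₃ α₁ α₂ α₃ _ _ _ _ _ _ Δ Δ-unit Δ-nonsquare
         (ε , ε-unit , T , _ , TᵗGT≈H) =
  [ case-p∣a₁ , [ case-p∣a₂ , case-p∣a₃ ]′ ]′ (exactly-one-divisible {A₁} {A₂} {A₃} discriminant-exactly-p)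
  where
  open Proof
  open PrimeModulus p-prime
  open Witness p-prime 3<p u u⊥p a₁ a₂ a₃ α₁ α₂ α₃ Δ Δ-unit Δ-nonsquare
  open Isometry ε ε-unit T TᵗGT≈H
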